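{- Let $q$ be a prime power and $E\subseteq\mathbb{F}_q^2$. Suppose that $|E|\,|\mathrm{Dir}(E)|>q^2$. Then there exists $e\in E$ such that $|E\cdot e|>q/2$.
   Context: For $E\subseteq\mathbb{F}_q^2$, the direction set $\mathrm{Dir}(E)\subseteq\mathbb{F}_q$ is the set of $\theta\in\mathbb{F}_q$ such that $(\lambda,\lambda\theta)\in E$ for some $\lambda\in\mathbb{F}_q\setminus\{0\}$. For $e\in\mathbb{F}_q^2$, $E\cdot e=\{u\cdot e: u\in E\}$ with $u\cdot e=u_1e_1+u_2e_2$. -}

module Defs where

open import Data.Nat using (ℕ; suc; _^_)
open import Data.Nat.Primality using (Prime)
open import Data.Fin using (Fin; _≟_)
open import Data.Fin.Properties using (any?)
open import Data.Bool using (Bool; true)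
open import Data.List using (List; length; filterᵇ; allFin; concatMap; map)
open import Data.Product using (_×_; _,_; Σ; ∃; ∃-syntax)
open import Relation.Nullary using (¬_; Dec; yes; no)
open import Relation.Nullary.Decidable using (⌊_⌋; _×-dec_; ¬?)
open import Relation.Binary.PropositionalEquality using (_≡_)
open import Algebra.Structures using (IsCommutativeRing)

IsPrimePower : ℕ → Set
IsPrimePower q = ∃[ p ] ∃[ k ] (Prime p × q ≡ p ^ suc k)

record FiniteField (q : ℕ) : Set where
  field
    _+_ _*_ : Fin q → Fin q → Fin q
    -_      : Fin q → Fin q
    0# 1#   : Fin q
    isCommutativeRing : IsCommutativeRing _≡_ _+_ _*_ -_ 0# 1#
    0≢1     : ¬ (0# ≡ 1#)
    inverse : (x : Fin q) → ¬ (x ≡ 0#) → ∃[ y ] (x * y ≡ 1#)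

Point : ℕ → Set
Point q = Fin q × Fin q

SubsetF2 : ℕ → Set
SubsetF2 q = Point q → Bool

allPoints : (q : ℕ) → List (Point q)
allPoints q = concatMap (λ a → map (λ b → (a , b)) (allFin q)) (allFin q)

cardE : {q : ℕ} → SubsetF2 q → ℕ
cardE {q} E = length (filterᵇ E (allPoints q))

cardF : {q : ℕ} → {P : Fin q → Set} → ((x : Fin q) → Dec (P x)) → ℕ
cardF {q} P? = length (filterᵇ (λ x → ⌊ P? x ⌋) (allFin q))

module _ {q : ℕ} (F : FiniteField q) where
  open FiniteField F

  dot : Point q → Point q → Fin q
  dot (u₁ , u₂) (e₁ , e₂) = (u₁ * e₁) + (u₂ * e₂)

  InDir : SubsetF2 q → Fin q → Set
  InDir E θ = ∃[ l ] (¬ (l ≡ 0#) × E (l , l * θ) ≡ true)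

  inDir? : (E : SubsetF2 q) → (θ : Fin q) → Dec (InDir E θ)
  inDir? E θ = any? (λ l → ¬? (l ≟ 0#) ×-dec (E (l , l * θ) Data.Bool.≟ true))

  cardDir : SubsetF2 q → ℕ
  cardDir E = cardF (inDir? E)

  InDotSet : SubsetF2 q → Point q → Fin q → Set
  InDotSet E e t = ∃[ u₁ ] ∃[ u₂ ] (E (u₁ , u₂) ≡ true × dot (u₁ , u₂) e ≡ t)

  inDotSet? : (E : SubsetF2 q) → (e : Point q) → (t : Fin q) → Dec (InDotSet E e t)
  inDotSet? E e t = any? (λ u₁ → any? (λ u₂ →
    (E (u₁ , u₂) Data.Bool.≟ true) ×-dec (dot (u₁ , u₂) e ≟ t)))

  cardDotSet : SubsetF2 q → Point q → ℕ
  cardDotSet E e = cardF (inDotSet? E e)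

module Submission where

-- Write N = |E|, and for e ∈ F_q² let collisions e be the number of pairs (u , v) ∈ E² with
-- u · e = v · e, i.e. the sum of the squares of the fibres of u ↦ u · e on E. Cauchy–Schwarz over
-- the fibres gives N² ≤ |E · e| · collisions e, and collisions e only depends on the line spanned
-- by e. Summed over the q + 1 lines through the origin, a pair u ≠ v is counted at most once
-- (only the line orthogonal to u − v can see it) and a pair u = v exactly q + 1 times, so the
-- total is at most N² + qN. If every e ∈ E had |E · e| ≤ q/2, each line in Dir(E) would contribute
-- at least 2N²/q and every other line N²/q; hence N²(q + 1 + |Dir(E)|) ≤ q(N² + qN), that is
-- N |Dir(E)| < q², contradicting the hypothesis.

open import Defs
open import Algebra.Bundles using (CommutativeRing)
open import Data.Bool using (Bool; true; false)
import Data.Bool.Properties as Boolₚ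
open import Data.Empty using (⊥-elim)
open import Data.Fin using (Fin; zero; suc; _≟_)
import Data.Fin.Properties as Finₚ
open import Data.List using (List; _∷_; _++_; length; filterᵇ; tabulate; concat; map; allFin)
open import Data.List.Properties using (filter-++; length-++; length-filter; length-tabulate; map-tabulate)
open import Data.Nat as ℕ using (ℕ)
open import Data.Product using (_×_; _,_; proj₁; proj₂; ∃-syntax)
open import Data.Product.Properties using (≡-dec)
open import Data.Sum using (inj₁; inj₂)
open import Function using (_∘_; id)
open import Function.Bundles using (_⇔_; mk⇔)
open import Level using (0ℓ)
open import Relation.Binary.PropositionalEquality
open import Relation.Nullary using (Dec; yes; no; does)
open import Relation.Nullary.Decidable using (⌊_⌋; T?; dec-true; does-⇔; _×-dec_)
open import Relation.Unary using (Pred; Decidable)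

module Plane {q : ℕ} (F : FiniteField q) where

  commutativeRing : CommutativeRing 0ℓ 0ℓ
  commutativeRing = record { isCommutativeRing = FiniteField.isCommutativeRing F }

  open FiniteField F using (inverse)
  open CommutativeRing commutativeRing
    using (_+_; _*_; _-_; 0#; 1#; ring; commutativeSemiring;
           *-assoc; *-comm; *-identityˡ; *-identityʳ; +-identityˡ; +-identityʳ; zeroˡ; zeroʳ)
  open import Algebra.Properties.Ring ring
    using (+-cancelˡ; +-cancelʳ; //-rightDividesˡ; x∙y⁻¹≈ε⇒x≈y)
  open import Algebra.Solver.Ring.NaturalCoefficients.Default commutativeSemiring
  open ≡-Reasoning

  *-cancelˡ-nonZero : ∀ x y z → x ≢ 0# → x * y ≡ x * z → y ≡ z
  *-cancelˡ-nonZero x y z x≢0 xy≡xz with x⁻¹ , xx⁻¹≡1 ← inverse x x≢0 = begin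
    y                ≡⟨ *-identityˡ y ⟨
    1# * y           ≡⟨ cong (_* y) (trans (sym xx⁻¹≡1) (*-comm x x⁻¹)) ⟩
    (x⁻¹ * x) * y    ≡⟨ *-assoc x⁻¹ x y ⟩
    x⁻¹ * (x * y)    ≡⟨ cong (x⁻¹ *_) xy≡xz ⟩
    x⁻¹ * (x * z)    ≡⟨ *-assoc x⁻¹ x z ⟨
    (x⁻¹ * x) * z    ≡⟨ cong (_* z) (trans (*-comm x⁻¹ x) xx⁻¹≡1) ⟩
    1# * z           ≡⟨ *-identityˡ z ⟩
    z                ∎

  _⊕_ _⊖_ : Point q → Point q → Point q
  (u₁ , u₂) ⊕ (v₁ , v₂) = (u₁ + v₁ , u₂ + v₂)
  (u₁ , u₂) ⊖ (v₁ , v₂) = (u₁ - v₁ , u₂ - v₂)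

  dot-distribʳ-⊕ : ∀ u v e → dot F u e + dot F v e ≡ dot F (u ⊕ v) e
  dot-distribʳ-⊕ (u₁ , u₂) (v₁ , v₂) (e₁ , e₂) =
    solve 6 (λ u₁ u₂ v₁ v₂ e₁ e₂ → (u₁ :* e₁ :+ u₂ :* e₂) :+ (v₁ :* e₁ :+ v₂ :* e₂)
                                 := (u₁ :+ v₁) :* e₁ :+ (u₂ :+ v₂) :* e₂)
            refl u₁ u₂ v₁ v₂ e₁ e₂

  ⊖-⊕-cancel : ∀ u v → (u ⊖ v) ⊕ v ≡ u
  ⊖-⊕-cancel (u₁ , u₂) (v₁ , v₂) = cong₂ _,_ (//-rightDividesˡ v₁ u₁) (//-rightDividesˡ v₂ u₂)

  dot-⊖-≡0 : ∀ u v e → dot F u e ≡ dot F v e → dot F (u ⊖ v) e ≡ 0#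
  dot-⊖-≡0 u v e u·e≡v·e = +-cancelʳ (dot F v e) _ _ (begin
    dot F (u ⊖ v) e + dot F v e   ≡⟨ dot-distribʳ-⊕ (u ⊖ v) v e ⟩
    dot F ((u ⊖ v) ⊕ v) e         ≡⟨ cong (λ w → dot F w e) (⊖-⊕-cancel u v) ⟩
    dot F u e                     ≡⟨ u·e≡v·e ⟩
    dot F v e                     ≡⟨ +-identityˡ (dot F v e) ⟨
    0# + dot F v e                ∎)

  ⊖-≢0 : ∀ {u v} → u ≢ v → u ⊖ v ≢ (0# , 0#)
  ⊖-≢0 {u₁ , u₂} {v₁ , v₂} u≢v u⊖v≡0 = u≢v (cong₂ _,_
    (x∙y⁻¹≈ε⇒x≈y u₁ v₁ (cong proj₁ u⊖v≡0))
    (x∙y⁻¹≈ε⇒x≈y u₂ v₂ (cong proj₂ u⊖v≡0)))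

  dot-scale : ∀ u l θ → dot F u (l , l * θ) ≡ l * dot F u (1# , θ)
  dot-scale (u₁ , u₂) l θ =
    solve 4 (λ u₁ u₂ l θ → u₁ :* l :+ u₂ :* (l :* θ) := l :* (u₁ :* con 1 :+ u₂ :* θ))
            refl u₁ u₂ l θ

  dot-scale-⇔ : ∀ u v l θ → l ≢ 0# →
                dot F u (l , l * θ) ≡ dot F v (l , l * θ) ⇔ dot F u (1# , θ) ≡ dot F v (1# , θ)
  dot-scale-⇔ u v l θ l≢0 = mk⇔
    (λ eq → *-cancelˡ-nonZero l _ _ l≢0
              (trans (sym (dot-scale u l θ)) (trans eq (dot-scale v l θ))))
    (λ eq → trans (dot-scale u l θ) (trans (cong (l *_) eq) (sym (dot-scale v l θ))))

  -- One representative of each of the q + 1 lines through the origin.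
  line : Fin (ℕ.suc q) → Point q
  line zero    = (0# , 1#)
  line (suc θ) = (1# , θ)

  line-unique : ∀ {w} → w ≢ (0# , 0#) → ∀ {i j} →
                dot F w (line i) ≡ 0# → dot F w (line j) ≡ 0# → i ≡ j
  line-unique {w₁ , w₂} w≢0 {i} {j} w·i≡0 w·j≡0 with w₂ ≟ 0#
  ... | yes refl = trans (on-axis i w·i≡0) (sym (on-axis j w·j≡0))
    where
    on-axis : ∀ i → dot F (w₁ , 0#) (line i) ≡ 0# → i ≡ zero
    on-axis zero    _     = refl
    on-axis (suc θ) w·θ≡0 = ⊥-elim (w≢0 (cong (_, 0#) (begin
      w₁                 ≡⟨ *-identityʳ w₁ ⟨
      w₁ * 1#            ≡⟨ +-identityʳ (w₁ * 1#) ⟨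
      w₁ * 1# + 0#       ≡⟨ cong (w₁ * 1# +_) (zeroˡ θ) ⟨
      w₁ * 1# + 0# * θ   ≡⟨ w·θ≡0 ⟩
      0#                 ∎)))
  ... | no w₂≢0 = off-axis i j w·i≡0 w·j≡0
    where
    w·line₀≢0 : dot F (w₁ , w₂) (0# , 1#) ≢ 0#
    w·line₀≢0 w·0≡0 = w₂≢0 (trans (sym (trans (cong₂ _+_ (zeroʳ w₁) (*-identityʳ w₂))
                                              (+-identityˡ w₂)))
                                  w·0≡0)
    off-axis : ∀ i j → dot F (w₁ , w₂) (line i) ≡ 0# → dot F (w₁ , w₂) (line j) ≡ 0# → i ≡ j
    off-axis zero    _        w·0≡0 _     = ⊥-elim (w·line₀≢0 w·0≡0)
    off-axis (suc _) zero     _     w·0≡0 = ⊥-elim (w·line₀≢0 w·0≡0)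
    off-axis (suc θ) (suc θ′) w·θ≡0 w·θ′≡0 = cong suc (*-cancelˡ-nonZero w₂ θ θ′ w₂≢0
      (+-cancelˡ (w₁ * 1#) _ _ (trans w·θ≡0 (sym w·θ′≡0))))

-- Opened only after Plane, whose _+_ and _*_ are the field operations.
open import Data.Nat hiding (_≟_)
open import Data.Nat.Properties hiding (_≟_)
open import Data.Nat.Tactic.RingSolver using (solve-∀)
open import Algebra.Properties.Semiring.Sum +-*-semiring
  using (sum; sum-syntax; sum-cong-≗; ∑-distrib-+; ∑-comm; *-distribˡ-sum; *-distribʳ-sum)

𝟙 : Bool → ℕ
𝟙 true  = 1
𝟙 false = 0

𝟙≤1 : ∀ b → 𝟙 b ≤ 1
𝟙≤1 true  = ≤-refl
𝟙≤1 false = z≤n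

𝟙-idem : ∀ b → 𝟙 b * 𝟙 b ≡ 𝟙 b
𝟙-idem true  = refl
𝟙-idem false = refl

-- Via does rather than ⌊_⌋, so that δ (suc x) (suc y) reduces to δ x y.
δ : ∀ {n} → Fin n → Fin n → ℕ
δ x y = 𝟙 (does (x ≟ y))

δ-refl : ∀ {n} (x : Fin n) → δ x x ≡ 1
δ-refl x = cong 𝟙 (dec-true (x ≟ x) refl)

δ-sym : ∀ {n} (x y : Fin n) → δ x y ≡ δ y x
δ-sym x y = cong 𝟙 (does-⇔ (mk⇔ sym sym) (x ≟ y) (y ≟ x))

sum-mono-≤ : ∀ {n} {f g : Fin n → ℕ} → (∀ i → f i ≤ g i) → sum f ≤ sum g
sum-mono-≤ {zero}  f≤g = z≤n
sum-mono-≤ {suc n} f≤g = +-mono-≤ (f≤g zero) (sum-mono-≤ (f≤g ∘ suc))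

∑-const : ∀ n c → ∑[ i < n ] c ≡ n * c
∑-const zero    c = refl
∑-const (suc n) c = cong (c +_) (∑-const n c)

∑-zero : ∀ {n} {f : Fin n → ℕ} → (∀ i → f i ≡ 0) → sum f ≡ 0
∑-zero {n} f≡0 = trans (sum-cong-≗ f≡0) (trans (∑-const n 0) (*-zeroʳ n))

∑-δ : ∀ {n} (x : Fin n) (h : Fin n → ℕ) → ∑[ t < n ] (δ x t * h t) ≡ h x
∑-δ {suc n} zero    h =
  trans (cong₂ _+_ (*-identityˡ (h zero)) (∑-zero {n} (λ _ → refl))) (+-identityʳ (h zero))
∑-δ {suc n} (suc x) h = ∑-δ x (h ∘ suc)

∑-𝟙-≤1 : ∀ {n p} {P : Pred (Fin n) p} (P? : Decidable P) →
         (∀ {i j} → P i → P j → i ≡ j) → ∑[ i < n ] 𝟙 (does (P? i)) ≤ 1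
∑-𝟙-≤1 {zero}  P? unique = z≤n
∑-𝟙-≤1 {suc n} {P = P} P? unique = split (P? zero)
  where
  absent : P zero → ∀ i → 𝟙 (does (P? (suc i))) ≡ 0
  absent P0 i with P? (suc i)
  ... | yes Pi = ⊥-elim (Finₚ.0≢1+n (unique P0 Pi))
  ... | no  _  = refl
  split : (P0? : Dec (P zero)) → 𝟙 (does P0?) + ∑[ i < n ] 𝟙 (does (P? (suc i))) ≤ 1
  split (no _)   = ∑-𝟙-≤1 (P? ∘ suc) (λ Pi Pj → Finₚ.suc-injective (unique Pi Pj))
  split (yes P0) = s≤s (≤-reflexive (∑-zero (absent P0)))

length-filterᵇ-∷ : ∀ {a} {A : Set a} (p : A → Bool) x xs →
                   length (filterᵇ p (x ∷ xs)) ≡ 𝟙 (p x) + length (filterᵇ p xs)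
length-filterᵇ-∷ p x xs with p x
... | true  = refl
... | false = refl

length-filterᵇ-tabulate : ∀ {a n} {A : Set a} (p : A → Bool) (f : Fin n → A) →
                          length (filterᵇ p (tabulate f)) ≡ ∑[ i < n ] 𝟙 (p (f i))
length-filterᵇ-tabulate {n = zero}  p f = refl
length-filterᵇ-tabulate {n = suc n} p f =
  trans (length-filterᵇ-∷ p (f zero) (tabulate (f ∘ suc)))
        (cong (𝟙 (p (f zero)) +_) (length-filterᵇ-tabulate p (f ∘ suc)))

length-filterᵇ-concat-tabulate : ∀ {a n} {A : Set a} (p : A → Bool) (f : Fin n → List A) →
  length (filterᵇ p (concat (tabulate f))) ≡ ∑[ i < n ] length (filterᵇ p (f i))
length-filterᵇ-concat-tabulate {n = zero}  p f = refl
length-filterᵇ-concat-tabulate {n = suc n} p f = begin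
  length (filterᵇ p (f zero ++ rest))
    ≡⟨ cong length (filter-++ (T? ∘ p) (f zero) rest) ⟩
  length (filterᵇ p (f zero) ++ filterᵇ p rest)
    ≡⟨ length-++ (filterᵇ p (f zero)) ⟩
  length (filterᵇ p (f zero)) + length (filterᵇ p rest)
    ≡⟨ cong (length (filterᵇ p (f zero)) +_) (length-filterᵇ-concat-tabulate p (f ∘ suc)) ⟩
  length (filterᵇ p (f zero)) + ∑[ i < n ] length (filterᵇ p (f (suc i)))
    ∎
  where
  open ≡-Reasoning
  rest = concat (tabulate (f ∘ suc))

sgn : ℕ → ℕ
sgn zero    = 0
sgn (suc _) = 1

sgn≤1 : ∀ n → sgn n ≤ 1
sgn≤1 zero    = z≤n
sgn≤1 (suc _) = ≤-refl

2m[m+d]≤m²+[m+d]² : ∀ m d → 2 * (m * (m + d)) ≤ m * m + (m + d) * (m + d)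
2m[m+d]≤m²+[m+d]² m d = subst (2 * (m * (m + d)) ≤_) (expand m d) (m≤m+n _ (d * d))
  where
  expand : ∀ m d → 2 * (m * (m + d)) + d * d ≡ m * m + (m + d) * (m + d)
  expand = solve-∀

2mn≤m²+n² : ∀ m n → 2 * (m * n) ≤ m * m + n * n
2mn≤m²+n² m n with ≤-total m n
... | inj₁ m≤n with d , refl ← m≤n⇒∃[o]m+o≡n m≤n = 2m[m+d]≤m²+[m+d]² m d
... | inj₂ n≤m with d , refl ← m≤n⇒∃[o]m+o≡n n≤m =
  subst₂ _≤_ (cong (2 *_) (*-comm n m)) (+-comm (n * n) (m * m)) (2m[m+d]≤m²+[m+d]² n d)

2as≤ma²+r : ∀ a s r m → s * s ≤ m * r → 2 * (a * s) ≤ m * (a * a) + r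
2as≤ma²+r a zero    r zero _ = ≤-trans (≤-reflexive (cong (2 *_) (*-zeroʳ a))) z≤n
2as≤ma²+r a (suc s) r zero ()
2as≤ma²+r a s r m@(suc _) s²≤mr = *-cancelˡ-≤ m (begin
  m * (2 * (a * s))          ≡⟨ regroup m a s ⟩
  2 * ((m * a) * s)          ≤⟨ 2mn≤m²+n² (m * a) s ⟩
  (m * a) * (m * a) + s * s  ≤⟨ +-monoʳ-≤ ((m * a) * (m * a)) s²≤mr ⟩
  (m * a) * (m * a) + m * r  ≡⟨ factor m a r ⟩
  m * (m * (a * a) + r)      ∎)
  where
  open ≤-Reasoning
  regroup : ∀ m a s → m * (2 * (a * s)) ≡ 2 * ((m * a) * s)
  regroup = solve-∀
  factor : ∀ m a r → (m * a) * (m * a) + m * r ≡ m * (m * (a * a) + r)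
  factor = solve-∀

cauchy-schwarz : ∀ {n} (c : Fin n → ℕ) →
                 sum c * sum c ≤ (∑[ i < n ] sgn (c i)) * (∑[ i < n ] (c i * c i))
cauchy-schwarz {zero}  c = z≤n
cauchy-schwarz {suc n} c with c zero
... | zero = cauchy-schwarz (c ∘ suc)
... | a@(suc _) = begin
  (a + s) * (a + s)                 ≡⟨ expand a s ⟩
  a * a + 2 * (a * s) + s * s       ≤⟨ +-mono-≤ (+-monoʳ-≤ (a * a) (2as≤ma²+r a s r m ih)) ih ⟩
  a * a + (m * (a * a) + r) + m * r ≡⟨ factor a m r ⟩
  (1 + m) * (a * a + r)             ∎
  where
  open ≤-Reasoning
  s = sum (c ∘ suc)
  r = ∑[ i < n ] (c (suc i) * c (suc i))
  m = ∑[ i < n ] sgn (c (suc i))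
  ih = cauchy-schwarz (c ∘ suc)
  expand : ∀ a s → (a + s) * (a + s) ≡ a * a + 2 * (a * s) + s * s
  expand = solve-∀
  factor : ∀ a m r → a * a + (m * (a * a) + r) + m * r ≡ (1 + m) * (a * a + r)
  factor = solve-∀

∑² : ∀ {m n} → (Fin m × Fin n → ℕ) → ℕ
∑² {m} {n} f = ∑[ a < m ] ∑[ b < n ] f (a , b)

module _ {m n : ℕ} where

  private
    rows : (Fin m × Fin n → ℕ) → Fin m → ℕ
    rows f a = ∑[ b < n ] f (a , b)

  ∑²-cong : ∀ {f g : Fin m × Fin n → ℕ} → (∀ u → f u ≡ g u) → ∑² f ≡ ∑² g
  ∑²-cong f≡g = sum-cong-≗ (λ a → sum-cong-≗ (λ b → f≡g (a , b)))

  ∑²-mono-≤ : ∀ {f g : Fin m × Fin n → ℕ} → (∀ u → f u ≤ g u) → ∑² f ≤ ∑² g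
  ∑²-mono-≤ f≤g = sum-mono-≤ (λ a → sum-mono-≤ (λ b → f≤g (a , b)))

  ∑²-zero : ∀ {f : Fin m × Fin n → ℕ} → (∀ u → f u ≡ 0) → ∑² f ≡ 0
  ∑²-zero f≡0 = ∑-zero (λ a → ∑-zero (λ b → f≡0 (a , b)))

  ∑²-distrib-+ : ∀ (f g : Fin m × Fin n → ℕ) → ∑² (λ u → f u + g u) ≡ ∑² f + ∑² g
  ∑²-distrib-+ f g = trans (sum-cong-≗ (λ a → ∑-distrib-+ (λ b → f (a , b)) (λ b → g (a , b))))
                           (∑-distrib-+ (rows f) (rows g))

  *-distribˡ-∑² : ∀ c (f : Fin m × Fin n → ℕ) → c * ∑² f ≡ ∑² (λ u → c * f u)
  *-distribˡ-∑² c f = trans (*-distribˡ-sum c (rows f))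
                            (sum-cong-≗ (λ a → *-distribˡ-sum c (λ b → f (a , b))))

  *-distribʳ-∑² : ∀ c (f : Fin m × Fin n → ℕ) → ∑² f * c ≡ ∑² (λ u → f u * c)
  *-distribʳ-∑² c f = trans (*-distribʳ-sum c (rows f))
                            (sum-cong-≗ (λ a → *-distribʳ-sum c (λ b → f (a , b))))

  ∑²-*-∑² : ∀ (f g : Fin m × Fin n → ℕ) → ∑² f * ∑² g ≡ ∑² (λ u → ∑² (λ v → f u * g v))
  ∑²-*-∑² f g = trans (*-distribʳ-∑² (∑² g) f) (∑²-cong (λ u → *-distribˡ-∑² (f u) g))

  ∑-∑²-comm : ∀ {k} (f : Fin k → Fin m × Fin n → ℕ) →
              ∑[ t < k ] ∑² (f t) ≡ ∑² (λ u → ∑[ t < k ] f t u)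
  ∑-∑²-comm f = trans (∑-comm (λ t → rows (f t)))
                      (sum-cong-≗ (λ a → ∑-comm (λ t b → f t (a , b))))

  δ² : Fin m × Fin n → Fin m × Fin n → ℕ
  δ² (u₁ , u₂) (v₁ , v₂) = δ u₁ v₁ * δ u₂ v₂

  δ²-refl : ∀ u → δ² u u ≡ 1
  δ²-refl (u₁ , u₂) = cong₂ _*_ (δ-refl u₁) (δ-refl u₂)

  ∑²-δ² : ∀ u (h : Fin m × Fin n → ℕ) → ∑² (λ v → δ² u v * h v) ≡ h u
  ∑²-δ² (u₁ , u₂) h = begin
    ∑[ a < m ] ∑[ b < n ] (δ u₁ a * δ u₂ b * h (a , b))
      ≡⟨ sum-cong-≗ (λ a → sum-cong-≗ (λ b → *-assoc (δ u₁ a) (δ u₂ b) (h (a , b)))) ⟩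
    ∑[ a < m ] ∑[ b < n ] (δ u₁ a * (δ u₂ b * h (a , b)))
      ≡⟨ sum-cong-≗ (λ a → *-distribˡ-sum (δ u₁ a) (λ b → δ u₂ b * h (a , b))) ⟨
    ∑[ a < m ] (δ u₁ a * ∑[ b < n ] (δ u₂ b * h (a , b)))
      ≡⟨ sum-cong-≗ (λ a → cong (δ u₁ a *_) (∑-δ u₂ (λ b → h (a , b)))) ⟩
    ∑[ a < m ] (δ u₁ a * h (a , u₂))
      ≡⟨ ∑-δ u₁ (λ a → h (a , u₂)) ⟩
    h (u₁ , u₂)
      ∎
    where open ≡-Reasoning

n²+qn²+n²d≤q[n²+qn]⇒nd≤q² : ∀ q n d →
  n * n + (q * (n * n) + n * n * d) ≤ q * (n * n + q * n) → n * d ≤ q * q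
n²+qn²+n²d≤q[n²+qn]⇒nd≤q² q zero      d _     = z≤n
n²+qn²+n²d≤q[n²+qn]⇒nd≤q² q n@(suc _) d bound = begin
  n * d      ≤⟨ *-monoʳ-≤ n (n≤1+n d) ⟩
  n * suc d  ≤⟨ *-cancelˡ-≤ n (+-cancelˡ-≤ (q * (n * n)) _ _ regrouped) ⟩
  q * q      ∎
  where
  open ≤-Reasoning
  regroupˡ : ∀ q n d → n * n + (q * (n * n) + n * n * d) ≡ q * (n * n) + n * (n * suc d)
  regroupˡ = solve-∀
  regroupʳ : ∀ q n → q * (n * n + q * n) ≡ q * (n * n) + n * (q * q)
  regroupʳ = solve-∀
  regrouped : q * (n * n) + n * (n * suc d) ≤ q * (n * n) + n * (q * q)
  regrouped = subst₂ _≤_ (regroupˡ q n d) (regroupʳ q n) bound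

module Energy {q : ℕ} (F : FiniteField q) (E : SubsetF2 q) where
  open FiniteField F using (0#; 1#) renaming (_*_ to _·_)
  open Plane F using (line; line-unique; dot-scale-⇔; dot-⊖-≡0; ⊖-≢0)

  𝟙E : Point q → ℕ
  𝟙E u = 𝟙 (E u)

  N : ℕ
  N = ∑² 𝟙E

  cardE≡N : cardE E ≡ N
  cardE≡N = begin
    length (filterᵇ E (concat (map row (tabulate id))))
      ≡⟨ cong (length ∘ filterᵇ E ∘ concat) (map-tabulate id row) ⟩
    length (filterᵇ E (concat (tabulate row)))
      ≡⟨ length-filterᵇ-concat-tabulate E row ⟩
    ∑[ a < q ] length (filterᵇ E (map (a ,_) (tabulate id)))
      ≡⟨ sum-cong-≗ (λ a → cong (length ∘ filterᵇ E) (map-tabulate id (a ,_))) ⟩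
    ∑[ a < q ] length (filterᵇ E (tabulate (a ,_)))
      ≡⟨ sum-cong-≗ (λ a → length-filterᵇ-tabulate E (a ,_)) ⟩
    N ∎
    where
    open ≡-Reasoning
    row : Fin q → List (Point q)
    row a = map (a ,_) (allFin q)

  fibre : Point q → Fin q → ℕ
  fibre e t = ∑² (λ u → 𝟙E u * δ (dot F u e) t)

  collisions : Point q → ℕ
  collisions e = ∑² (λ u → ∑² (λ v → 𝟙E u * 𝟙E v * δ (dot F u e) (dot F v e)))

  ∑-fibre : ∀ e → sum (fibre e) ≡ N
  ∑-fibre e = trans (∑-∑²-comm (λ t u → 𝟙E u * δ (dot F u e) t)) (∑²-cong counted-once)
    where
    counted-once : ∀ u → ∑[ t < q ] (𝟙E u * δ (dot F u e) t) ≡ 𝟙E u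
    counted-once u = trans (sum-cong-≗ (λ t → *-comm (𝟙E u) (δ (dot F u e) t)))
                           (∑-δ (dot F u e) (λ _ → 𝟙E u))

  ∑-fibre² : ∀ e → ∑[ t < q ] (fibre e t * fibre e t) ≡ collisions e
  ∑-fibre² e = begin
    ∑[ t < q ] (fibre e t * fibre e t)
      ≡⟨ sum-cong-≗ (λ t → ∑²-*-∑² (X t) (X t)) ⟩
    ∑[ t < q ] ∑² (λ u → ∑² (λ v → X t u * X t v))
      ≡⟨ ∑-∑²-comm (λ t u → ∑² (λ v → X t u * X t v)) ⟩
    ∑² (λ u → ∑[ t < q ] ∑² (λ v → X t u * X t v))
      ≡⟨ ∑²-cong (λ u → ∑-∑²-comm (λ t v → X t u * X t v)) ⟩
    ∑² (λ u → ∑² (λ v → ∑[ t < q ] (X t u * X t v)))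
      ≡⟨ ∑²-cong (λ u → ∑²-cong (λ v → same-fibre u v)) ⟩
    collisions e ∎
    where
    open ≡-Reasoning
    X : Fin q → Point q → ℕ
    X t u = 𝟙E u * δ (dot F u e) t
    regroup : ∀ a b x y → a * x * (b * y) ≡ x * (a * b * y)
    regroup = solve-∀
    same-fibre : ∀ u v → ∑[ t < q ] (X t u * X t v) ≡ 𝟙E u * 𝟙E v * δ (dot F u e) (dot F v e)
    same-fibre u v = begin
      ∑[ t < q ] (X t u * X t v)
        ≡⟨ sum-cong-≗ (λ t → regroup (𝟙E u) (𝟙E v) (δ (dot F u e) t) (δ (dot F v e) t)) ⟩
      ∑[ t < q ] (δ (dot F u e) t * (𝟙E u * 𝟙E v * δ (dot F v e) t))
        ≡⟨ ∑-δ (dot F u e) (λ t → 𝟙E u * 𝟙E v * δ (dot F v e) t) ⟩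
      𝟙E u * 𝟙E v * δ (dot F v e) (dot F u e)
        ≡⟨ cong (𝟙E u * 𝟙E v *_) (δ-sym (dot F v e) (dot F u e)) ⟩
      𝟙E u * 𝟙E v * δ (dot F u e) (dot F v e) ∎

  sgn-fibre≤ : ∀ e t → sgn (fibre e t) ≤ 𝟙 ⌊ inDotSet? F E e t ⌋
  sgn-fibre≤ e t with inDotSet? F E e t
  ... | yes _    = sgn≤1 (fibre e t)
  ... | no t∉E·e = ≤-reflexive (cong sgn (∑²-zero outside))
    where
    outside : ∀ u → 𝟙E u * δ (dot F u e) t ≡ 0
    outside (u₁ , u₂) with E (u₁ , u₂) in u∈E | dot F (u₁ , u₂) e ≟ t
    ... | false | _         = refl
    ... | true  | no  _     = refl
    ... | true  | yes u·e≡t = ⊥-elim (t∉E·e (u₁ , u₂ , u∈E , u·e≡t))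

  cardDotSet≡ : ∀ e → cardDotSet F E e ≡ ∑[ t < q ] 𝟙 ⌊ inDotSet? F E e t ⌋
  cardDotSet≡ e = length-filterᵇ-tabulate (λ t → ⌊ inDotSet? F E e t ⌋) id

  cardDotSet≤q : ∀ e → cardDotSet F E e ≤ q
  cardDotSet≤q e = ≤-trans (length-filter (T? ∘ λ t → ⌊ inDotSet? F E e t ⌋) (allFin q))
                           (≤-reflexive (length-tabulate id))

  N²≤cardDotSet*collisions : ∀ e → N * N ≤ cardDotSet F E e * collisions e
  N²≤cardDotSet*collisions e = begin
    N * N
      ≡⟨ cong₂ _*_ (∑-fibre e) (∑-fibre e) ⟨
    sum (fibre e) * sum (fibre e)
      ≤⟨ cauchy-schwarz (fibre e) ⟩
    (∑[ t < q ] sgn (fibre e t)) * (∑[ t < q ] (fibre e t * fibre e t))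
      ≤⟨ *-mono-≤ support≤ (≤-reflexive (∑-fibre² e)) ⟩
    cardDotSet F E e * collisions e ∎
    where
    open ≤-Reasoning
    support≤ : ∑[ t < q ] sgn (fibre e t) ≤ cardDotSet F E e
    support≤ = ≤-trans (sum-mono-≤ (sgn-fibre≤ e)) (≤-reflexive (sym (cardDotSet≡ e)))

  N²≤q*collisions : ∀ e → N * N ≤ q * collisions e
  N²≤q*collisions e =
    ≤-trans (N²≤cardDotSet*collisions e) (*-monoˡ-≤ (collisions e) (cardDotSet≤q e))

  collisions-scale : ∀ l θ → l ≢ 0# → collisions (l , l · θ) ≡ collisions (1# , θ)
  collisions-scale l θ l≢0 = ∑²-cong (λ u → ∑²-cong (λ v →
    cong (λ b → 𝟙E u * 𝟙E v * 𝟙 b)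
         (does-⇔ (dot-scale-⇔ u v l θ l≢0) (dot F u (l , l · θ) ≟ dot F v (l , l · θ))
                                           (dot F u (1# , θ) ≟ dot F v (1# , θ)))))

  lines : Point q → Point q → ℕ
  lines u v = ∑[ i < suc q ] δ (dot F u (line i)) (dot F v (line i))

  lines≤ : ∀ u v → lines u v ≤ 1 + q * δ² u v
  lines≤ u v with ≡-dec _≟_ _≟_ u v
  ... | yes refl = begin
    lines u u         ≤⟨ sum-mono-≤ (λ i → 𝟙≤1 (does (dot F u (line i) ≟ dot F u (line i)))) ⟩
    ∑[ i < suc q ] 1  ≡⟨ ∑-const (suc q) 1 ⟩
    suc q * 1         ≡⟨ cong (λ d → 1 + q * d) (δ²-refl u) ⟨
    1 + q * δ² u u    ∎
    where open ≤-Reasoning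
  ... | no u≢v =
    ≤-trans (∑-𝟙-≤1 (λ i → dot F u (line i) ≟ dot F v (line i)) at-most-one) (m≤m+n 1 _)
    where
    at-most-one : ∀ {i j} → dot F u (line i) ≡ dot F v (line i) →
                  dot F u (line j) ≡ dot F v (line j) → i ≡ j
    at-most-one u·i≡v·i u·j≡v·j =
      line-unique (⊖-≢0 u≢v) (dot-⊖-≡0 u v _ u·i≡v·i) (dot-⊖-≡0 u v _ u·j≡v·j)

  ∑-collisions-line : ∑[ i < suc q ] collisions (line i) ≤ N * N + q * N
  ∑-collisions-line = begin
    ∑[ i < suc q ] collisions (line i)
      ≡⟨ ∑-∑²-comm (λ i u → ∑² (λ v → w u v * c i u v)) ⟩
    ∑² (λ u → ∑[ i < suc q ] ∑² (λ v → w u v * c i u v))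
      ≡⟨ ∑²-cong (λ u → ∑-∑²-comm (λ i v → w u v * c i u v)) ⟩
    ∑² (λ u → ∑² (λ v → ∑[ i < suc q ] (w u v * c i u v)))
      ≡⟨ ∑²-cong (λ u → ∑²-cong (λ v → *-distribˡ-sum (w u v) (λ i → c i u v))) ⟨
    ∑² (λ u → ∑² (λ v → w u v * lines u v))
      ≤⟨ ∑²-mono-≤ (λ u → ∑²-mono-≤ (λ v → *-monoʳ-≤ (w u v) (lines≤ u v))) ⟩
    ∑² (λ u → ∑² (λ v → w u v * (1 + q * δ² u v)))
      ≡⟨ ∑²-cong (λ u → ∑²-cong (λ v → expand (𝟙E u) (𝟙E v) q (δ² u v))) ⟩
    ∑² (λ u → ∑² (λ v → w u v + q * (𝟙E u * (δ² u v * 𝟙E v))))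
      ≡⟨ ∑²-cong (λ u → trans (∑²-distrib-+ (w u) (λ v → q * (𝟙E u * (δ² u v * 𝟙E v))))
                              (cong₂ _+_ (sym (*-distribˡ-∑² (𝟙E u) 𝟙E)) (diagonal u))) ⟩
    ∑² (λ u → 𝟙E u * N + q * 𝟙E u)
      ≡⟨ ∑²-distrib-+ (λ u → 𝟙E u * N) (λ u → q * 𝟙E u) ⟩
    ∑² (λ u → 𝟙E u * N) + ∑² (λ u → q * 𝟙E u)
      ≡⟨ cong₂ _+_ (*-distribʳ-∑² N 𝟙E) (*-distribˡ-∑² q 𝟙E) ⟨
    N * N + q * N ∎
    where
    open ≤-Reasoning
    w : Point q → Point q → ℕ
    w u v = 𝟙E u * 𝟙E v
    c : Fin (suc q) → Point q → Point q → ℕ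
    c i u v = δ (dot F u (line i)) (dot F v (line i))
    expand : ∀ a b q d → a * b * (1 + q * d) ≡ a * b + q * (a * (d * b))
    expand = solve-∀
    diagonal : ∀ u → ∑² (λ v → q * (𝟙E u * (δ² u v * 𝟙E v))) ≡ q * 𝟙E u
    diagonal u = begin-equality
      ∑² (λ v → q * (𝟙E u * (δ² u v * 𝟙E v)))
        ≡⟨ *-distribˡ-∑² q (λ v → 𝟙E u * (δ² u v * 𝟙E v)) ⟨
      q * ∑² (λ v → 𝟙E u * (δ² u v * 𝟙E v))
        ≡⟨ cong (q *_) (*-distribˡ-∑² (𝟙E u) (λ v → δ² u v * 𝟙E v)) ⟨
      q * (𝟙E u * ∑² (λ v → δ² u v * 𝟙E v))
        ≡⟨ cong (λ x → q * (𝟙E u * x)) (∑²-δ² u 𝟙E) ⟩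
      q * (𝟙E u * 𝟙E u)
        ≡⟨ cong (q *_) (𝟙-idem (E u)) ⟩
      q * 𝟙E u ∎

  Sparse : Set
  Sparse = ∀ e → E e ≡ true → 2 * cardDotSet F E e ≤ q

  𝟙Dir : Fin q → ℕ
  𝟙Dir θ = 𝟙 ⌊ inDir? F E θ ⌋

  cardDir≡ : cardDir F E ≡ sum 𝟙Dir
  cardDir≡ = length-filterᵇ-tabulate (λ θ → ⌊ inDir? F E θ ⌋) id

  2N²≤q*collisions : Sparse → ∀ θ → InDir F E θ → 2 * (N * N) ≤ q * collisions (1# , θ)
  2N²≤q*collisions sparse θ (l , l≢0 , e∈E) = begin
    2 * (N * N)                             ≤⟨ *-monoʳ-≤ 2 (N²≤cardDotSet*collisions e) ⟩
    2 * (cardDotSet F E e * collisions e)   ≡⟨ *-assoc 2 (cardDotSet F E e) (collisions e) ⟨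
    2 * cardDotSet F E e * collisions e     ≤⟨ *-monoˡ-≤ (collisions e) (sparse e e∈E) ⟩
    q * collisions e                        ≡⟨ cong (q *_) (collisions-scale l θ l≢0) ⟩
    q * collisions (1# , θ)                 ∎
    where
    open ≤-Reasoning
    e = (l , l · θ)

  line-bound : Sparse → ∀ θ → N * N + N * N * 𝟙Dir θ ≤ q * collisions (1# , θ)
  line-bound sparse θ with inDir? F E θ
  ... | yes θ∈Dir = subst (_≤ q * collisions (1# , θ)) (double (N * N))
                          (2N²≤q*collisions sparse θ θ∈Dir)
    where
    double : ∀ n → 2 * n ≡ n + n * 1
    double = solve-∀
  ... | no _ = subst (_≤ q * collisions (1# , θ))
                     (sym (trans (cong (N * N +_) (*-zeroʳ (N * N))) (+-identityʳ (N * N))))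
                     (N²≤q*collisions (1# , θ))

  sparse⇒energy-bound : Sparse → N * N + (q * (N * N) + N * N * cardDir F E) ≤ q * (N * N + q * N)
  sparse⇒energy-bound sparse = begin
    N * N + (q * (N * N) + N * N * cardDir F E)
      ≡⟨ cong (λ x → N * N + (q * (N * N) + N * N * x)) cardDir≡ ⟩
    N * N + (q * (N * N) + N * N * sum 𝟙Dir)
      ≡⟨ cong (N * N +_) (cong₂ _+_ (∑-const q (N * N)) (sym (*-distribˡ-sum (N * N) 𝟙Dir))) ⟨
    N * N + (∑[ θ < q ] (N * N) + ∑[ θ < q ] (N * N * 𝟙Dir θ))
      ≡⟨ cong (N * N +_) (∑-distrib-+ (λ _ → N * N) (λ θ → N * N * 𝟙Dir θ)) ⟨
    N * N + ∑[ θ < q ] (N * N + N * N * 𝟙Dir θ)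
      ≤⟨ +-mono-≤ (N²≤q*collisions (line zero)) (sum-mono-≤ (line-bound sparse)) ⟩
    ∑[ i < suc q ] (q * collisions (line i))
      ≡⟨ *-distribˡ-sum q (collisions ∘ line) ⟨
    q * ∑[ i < suc q ] collisions (line i)
      ≤⟨ *-monoʳ-≤ q ∑-collisions-line ⟩
    q * (N * N + q * N) ∎
    where open ≤-Reasoning

theorem4 : (q : ℕ) → IsPrimePower q → (F : FiniteField q) → (E : SubsetF2 q)
    → q * q < cardE E * cardDir F E
    → ∃[ e ] (E e ≡ true × q < 2 * cardDotSet F E e)
theorem4 q _ F E q²<|E||Dir| with Finₚ.any? (λ a → Finₚ.any? (λ b →
  (E (a , b) Boolₚ.≟ true) ×-dec (q <? 2 * cardDotSet F E (a , b))))
... | yes (a , b , e∈E , rich) = (a , b) , e∈E , rich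
... | no none = ⊥-elim (<⇒≱ q²<|E||Dir| (subst (λ n → n * cardDir F E ≤ q * q) (sym cardE≡N)
    (n²+qn²+n²d≤q[n²+qn]⇒nd≤q² q N (cardDir F E) (sparse⇒energy-bound sparse))))
  where
  open Energy F E
  sparse : Sparse
  sparse (a , b) e∈E = ≮⇒≥ (λ rich → none (a , b , e∈E , rich))
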